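{- Let $G$ be an $r$-line-graph on $n$ vertices of density $d$, and let $0<\lambda\leq\frac{1}{2\log_2 n}$. Then $G$ contains a subgraph $H$ of density at least $d(1-\lambda\log_2 n)$ such that $H$ is a $(\lambda,\frac{d}{2r})$-expander.
   Context: Let $A_1,\dots,A_r$ be pairwise disjoint finite sets. An $r$-line-graph is a graph $G$ with $V(G)\subset A_1\times\dots\times A_r$, two vertices adjacent iff they differ in exactly one coordinate; subgraphs are induced subgraphs. For $i\in[r]$, an $i$-block of $G$ is the set of all vertices of $G$ agreeing with a given vertex in all coordinates except possibly the $i$-th; a block is an $i$-block for some $i$. With $p(G)$ the number of blocks, $\mathrm{dens}(G)=\frac{r|V(G)|}{p(G)}$. $\delta(G)$ denotes the minimum size of a block of $G$. For $X\subset V(G)$, $N(X)$ is the set of vertices outside $X$ adjacent to some vertex of $X$. For $\lambda>0$, $G$ is a $\lambda$-expander if $|N(X)|\geq\lambda|X|$ for every $X\subset V(G)$ with $|X|\leq\frac12|V(G)|$; $G$ is a $(\lambda,d)$-expander if it is a $\lambda$-expander and $\delta(G)\geq d$.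
   Formalization: The parameter λ is taken to be a positive rational. -}

module Defs where

open import Data.Nat using (ℕ; zero; suc; _+_; _*_; _∸_; _^_; _≤_; _<_)
open import Data.Nat.Properties using () renaming (_≟_ to _≟ℕ_)
open import Data.Fin using (Fin)
open import Data.Vec using (Vec; lookup; _[_]≔_)
open import Data.Vec.Properties using (≡-dec)
open import Data.List using (List; []; _∷_; length; filter; map; allFin; deduplicate)
open import Data.Nat.ListAction using (sum)
open import Data.List.Relation.Unary.Unique.Propositional using (Unique)
open import Data.List.Relation.Unary.Any using (any?)
open import Data.List.Relation.Binary.Subset.Propositional using (_⊆_)
open import Data.List.Membership.Propositional using (_∈_)
open import Data.Product using (_×_)
open import Relation.Nullary using (¬?; _×-dec_)
open import Relation.Binary using (DecidableEquality)
open import Data.Integer using (∣_∣)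
open import Data.Rational using (ℚ; ↥_; ↧ₙ_)

-- Coordinates: the finite sets A_1,…,A_r are (w.l.o.g.) encoded as finite
-- sets of natural numbers, the i-th coordinate of a vertex lying in A_i;
-- disjointness of the A_i is automatic since a coordinate is identified
-- by its position i.
Vertex : ℕ → Set
Vertex r = Vec ℕ r

_≟V_ : ∀ {r} → DecidableEquality (Vertex r)
_≟V_ = ≡-dec _≟ℕ_

-- A vertex set: a finite list of vertices without repetitions.
-- (An r-line-graph is determined by its vertex set; subgraphs are induced.)
record VSet (r : ℕ) : Set where
  constructor vset
  field
    verts  : List (Vertex r)
    unique : Unique verts
open VSet public

∣_∣V : ∀ {r} → VSet r → ℕ
∣ G ∣V = length (verts G)

-- Key of the i-block containing v: v with its i-th coordinate erased
-- (two vertices are in the same i-block iff they agree outside coordinate i).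
key : ∀ {r} → Fin r → Vertex r → Vertex r
key i v = v [ i ]≔ 0

block : ∀ {r} → List (Vertex r) → Fin r → Vertex r → List (Vertex r)
block V i v = filter (λ u → key i u ≟V key i v) V

numBlocksAt : ∀ {r} → List (Vertex r) → Fin r → ℕ
numBlocksAt V i = length (deduplicate _≟V_ (map (key i) V))

p : ∀ {r} → List (Vertex r) → ℕ
p {r} V = sum (map (numBlocksAt V) (allFin r))

MinBlock≥ : ∀ {r} → List (Vertex r) → ℕ → Set
MinBlock≥ {r} V k = ∀ (v : Vertex r) → v ∈ V → ∀ (i : Fin r) → k ≤ length (block V i v)

diffCount : ∀ {r} → Vertex r → Vertex r → ℕ
diffCount {r} u v = length (filter (λ i → ¬? (lookup u i ≟ℕ lookup v i)) (allFin r))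

N : ∀ {r} → List (Vertex r) → List (Vertex r) → List (Vertex r)
N V X = filter (λ v → ¬? (any? (λ x → x ≟V v) X) ×-dec any? (λ x → diffCount x v ≟ℕ 1) X) V

num : ℚ → ℕ
num λ′ = ∣ ↥ λ′ ∣

den : ℚ → ℕ
den λ′ = ↧ₙ λ′

IsExpander : ∀ {r} → ℚ → List (Vertex r) → Set
IsExpander {r} λ′ V =
  ∀ (X : List (Vertex r)) → Unique X → X ⊆ V →
    2 * length X ≤ length V → num λ′ * length X ≤ den λ′ * length (N V X)

-- Logarithm comparisons with rational bounds, for n ≥ 1, a, b with b ≥ 1:
-- log₂ n ≤ a/b  ⇔  n^b ≤ 2^a ;   log₂ n ≥ a/b  ⇔  2^a ≤ n^b.
Log₂≤ : ℕ → ℕ → ℕ → Set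
Log₂≤ n a b = n ^ b ≤ 2 ^ a

Log₂≥ : ℕ → ℕ → ℕ → Set
Log₂≥ n a b = 2 ^ a ≤ n ^ b

-- Hypothesis λ ≤ 1/(2 log₂ n) (for n ≥ 1, λ = a/b > 0):
-- equivalent to log₂ n ≤ b/(2a)  (for n = 1 the right side is +∞, always true).
λ≤1/2log : ℚ → ℕ → Set
λ≤1/2log λ′ n = Log₂≤ n (den λ′) (2 * num λ′)

-- dens(H) ≥ dens(G)(1 − λ log₂ n), where n = |V(G)|, λ = a/b > 0,
-- dens(H) = r nH/pH, dens(G) = r n/pG.  Equivalently
-- λ log₂ n · n pH ≥ n pH − nH pG, i.e. (trivially if the right side ≤ 0)
-- log₂ n ≥ ((n pH − nH pG) b) / (a n pH).
DensBound : ∀ {r} → ℚ → List (Vertex r) → List (Vertex r) → Set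
DensBound λ′ G H =
  Log₂≥ (length G)
        ((p H * length G ∸ length H * p G) * den λ′)
        (num λ′ * length G * p H)

-- δ(H) ≥ dens(G)/(2r) = (r n / pG)/(2r) = n/(2 pG), n = |V(G)|:
-- every block B of H satisfies n ≤ 2 pG |B|.
MinBlockBound : ∀ {r} → List (Vertex r) → List (Vertex r) → Set
MinBlockBound {r} G H =
  ∀ (v : Vertex r) → v ∈ H → ∀ (i : Fin r) → length G ≤ 2 * p G * length (block H i v)

-- Shrink G step by step while keeping the invariant
--   dens(H) (1 − λ⌊log₂|H|⌋) ≥ dens(G) (1 − λ⌊log₂ n⌋).
-- If some block B of H has |B| < dens(G)/2r = n/(2 p(G)), delete it: the invariant gives
-- p(H) |B| < |H|, so losing |B| vertices and at least one block does not lower |H|/p(H).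
-- If some S with |S| ≤ |H|/2 has |N(S)| < λ|S|, pass to S or to Y = H ∖ (S ∪ N(S)).
-- No block meets both S and Y, so p(S) + p(Y) ≤ p(H); and the weights
-- w(X) = |X| (1 − λ⌊log₂|X|⌋) satisfy w(H) ≤ w(S) + w(Y), because ⌊log₂|S|⌋ < ⌊log₂|H|⌋
-- gains λ|S| > |N(S)|, which pays for the vertices of N(S). So one of S, Y keeps the invariant.
-- As |H| decreases, this stops at a (λ, d/2r)-expander, and since ⌊log₂ n⌋ ≤ log₂ n the
-- invariant yields the density bound.
module Submission where

open import Defs
open import Data.Fin using (Fin) renaming (_≟_ to _≟F_)
open import Data.List using (List; []; _∷_; length; filter; map; allFin; deduplicate; _++_)
open import Data.List.Properties using (filter-notAll; filter-some; length-filter; length-++)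
open import Data.List.Membership.Propositional using (_∈_; find; lose)
open import Data.List.Membership.Propositional.Properties
  using (∈-filter⁺; ∈-filter⁻; ∈-++⁺ˡ; ∈-++⁺ʳ; ∈-++⁻; ∈-map⁺; ∈-map⁻; ∈-deduplicate⁺; ∈-deduplicate⁻; ∈-allFin)
open import Data.List.Relation.Binary.Disjoint.Propositional using (Disjoint)
open import Data.List.Relation.Binary.Subset.Propositional using (_⊆_)
open import Data.List.Relation.Binary.Subset.Propositional.Properties using (Any-resp-⊆; ⊆-trans; filter-⊆)
open import Data.List.Relation.Unary.All as All using (All)
open import Data.List.Relation.Unary.All.Properties using (anti-mono)
open import Data.List.Relation.Unary.AllPairs using (_∷_; [])
open import Data.List.Relation.Unary.Any as Any using (Any; here; there; any?)
open import Data.List.Relation.Unary.Unique.Propositional using (Unique)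
import Data.List.Relation.Unary.Unique.Propositional.Properties as Unique
import Data.List.Relation.Unary.Unique.DecPropositional.Properties as DecUnique
open import Data.Nat using (ℕ; zero; suc; _+_; _*_; _∸_; _^_; _≤_; _<_; z≤n; s≤s; NonZero; >-nonZero; ⌊_/2⌋; ⌈_/2⌉; _≤?_; _<?_)
open import Data.Nat.Properties
open import Algebra.Properties.CommutativeSemigroup +-commutativeSemigroup using (interchange)
open import Data.Nat.Induction using (<-wellFounded)
open import Data.Nat.ListAction using (sum)
open import Data.Nat.Logarithm using (⌊log₂_⌋; ⌊log₂⌋-mono-≤; ⌊log₂[2*b]⌋≡1+⌊log₂b⌋)
open import Data.Nat.Logarithm.Core using (⌊log2⌋)
open import Data.Nat.Tactic.RingSolver using (solve-∀)
open import Data.Product using (Σ; ∃; _×_; _,_; proj₂)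
open import Data.Rational using (ℚ; 0ℚ) renaming (_<_ to _<ℚ_)
open import Data.Sum using (_⊎_; inj₁; inj₂; [_,_]′)
open import Data.Vec using (lookup; _[_]≔_)
open import Data.Vec.Properties using (lookup∘update′; []≔-lookup; []≔-idempotent)
open import Function using (id; _∘_)
open import Induction.WellFounded using (Acc; acc)
open import Level using (0ℓ)
open import Relation.Binary using (DecidableEquality)
open import Relation.Binary.PropositionalEquality
open import Relation.Nullary using (¬_; ¬?; yes; no; contradiction; _×-dec_; _⊎-dec_)
open import Relation.Unary using (Pred; Decidable)
open import Relation.Unary.Properties using (∁?)

-- Logarithms

2*⌊n/2⌋≤n : ∀ n → 2 * ⌊ n /2⌋ ≤ n
2*⌊n/2⌋≤n n = begin
  2 * ⌊ n /2⌋           ≡⟨ cong (⌊ n /2⌋ +_) (+-identityʳ ⌊ n /2⌋) ⟩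
  ⌊ n /2⌋ + ⌊ n /2⌋     ≤⟨ +-monoʳ-≤ ⌊ n /2⌋ (⌊n/2⌋≤⌈n/2⌉ n) ⟩
  ⌊ n /2⌋ + ⌈ n /2⌉     ≡⟨ ⌊n/2⌋+⌈n/2⌉≡n n ⟩
  n                     ∎
  where open ≤-Reasoning

-- ⌊log₂_⌋ is defined by well-founded recursion, so this recurses on the accessibility proof.
2^⌊log2⌋n≤n : ∀ n (rec : Acc _<_ (suc n)) → 2 ^ ⌊log2⌋ (suc n) rec ≤ suc n
2^⌊log2⌋n≤n zero    _        = ≤-refl
2^⌊log2⌋n≤n (suc n) (acc rs) = begin
  2 * 2 ^ ⌊log2⌋ (suc ⌊ n /2⌋) _  ≤⟨ *-monoʳ-≤ 2 (2^⌊log2⌋n≤n ⌊ n /2⌋ _) ⟩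
  2 * suc ⌊ n /2⌋                 ≡⟨ *-suc 2 ⌊ n /2⌋ ⟩
  2 + 2 * ⌊ n /2⌋                 ≤⟨ +-monoʳ-≤ 2 (2*⌊n/2⌋≤n n) ⟩
  2 + n                           ∎
  where open ≤-Reasoning

2^⌊log₂n⌋≤n : ∀ n .{{_ : NonZero n}} → 2 ^ ⌊log₂ n ⌋ ≤ n
2^⌊log₂n⌋≤n (suc n) = 2^⌊log2⌋n≤n n (<-wellFounded (suc n))

^-cancelˡ-≤ : ∀ m → 1 < m → ∀ {i j} → m ^ i ≤ m ^ j → i ≤ j
^-cancelˡ-≤ m 1<m {i} {j} mⁱ≤mʲ = ≮⇒≥ (λ j<i → <⇒≱ (^-monoʳ-< m 1<m j<i) mⁱ≤mʲ)

^≤2^⇒⌊log₂⌋*≤ : ∀ n k b .{{_ : NonZero n}} → n ^ k ≤ 2 ^ b → ⌊log₂ n ⌋ * k ≤ b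
^≤2^⇒⌊log₂⌋*≤ n k b nᵏ≤2ᵇ = ^-cancelˡ-≤ 2 ≤-refl (begin
  2 ^ (⌊log₂ n ⌋ * k)   ≡⟨ ^-*-assoc 2 ⌊log₂ n ⌋ k ⟨
  (2 ^ ⌊log₂ n ⌋) ^ k   ≤⟨ ^-monoˡ-≤ k (2^⌊log₂n⌋≤n n) ⟩
  n ^ k                 ≤⟨ nᵏ≤2ᵇ ⟩
  2 ^ b                 ∎)
  where open ≤-Reasoning

≤⌊log₂⌋*⇒2^≤^ : ∀ n k x .{{_ : NonZero n}} → x ≤ ⌊log₂ n ⌋ * k → 2 ^ x ≤ n ^ k
≤⌊log₂⌋*⇒2^≤^ n k x x≤ = begin
  2 ^ x                 ≤⟨ ^-monoʳ-≤ 2 x≤ ⟩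
  2 ^ (⌊log₂ n ⌋ * k)   ≡⟨ ^-*-assoc 2 ⌊log₂ n ⌋ k ⟨
  (2 ^ ⌊log₂ n ⌋) ^ k   ≤⟨ ^-monoˡ-≤ k (2^⌊log₂n⌋≤n n) ⟩
  n ^ k                 ∎
  where open ≤-Reasoning

2*m≤n⇒⌊log₂m⌋<⌊log₂n⌋ : ∀ {m n} .{{_ : NonZero m}} → 2 * m ≤ n → ⌊log₂ m ⌋ < ⌊log₂ n ⌋
2*m≤n⇒⌊log₂m⌋<⌊log₂n⌋ {m} 2m≤n = subst (_≤ _) (⌊log₂[2*b]⌋≡1+⌊log₂b⌋ m) (⌊log₂⌋-mono-≤ 2m≤n)

slack : ℕ → ℕ → ℕ → ℕ
slack a b h = b ∸ a * ⌊log₂ h ⌋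

slack-antitone : ∀ a b {h h′} → h′ ≤ h → slack a b h ≤ slack a b h′
slack-antitone a b h′≤h = ∸-monoʳ-≤ b (*-monoʳ-≤ a (⌊log₂⌋-mono-≤ h′≤h))

slack-split : ∀ a b {h x y m} .{{_ : NonZero x}} →
  a * ⌊log₂ h ⌋ ≤ b → h ≤ x + m + y → 2 * x ≤ h → y ≤ h → b * m < a * x →
  h * slack a b h ≤ x * slack a b x + y * slack a b y
slack-split a b {h} {x} {y} {m} aℓh≤b h≤x+m+y 2x≤h y≤h bm<ax = begin
  h * σh                        ≤⟨ *-monoˡ-≤ σh h≤x+m+y ⟩
  (x + m + y) * σh              ≡⟨ distrib x m y σh ⟩
  x * σh + y * σh + m * σh      ≤⟨ +-monoʳ-≤ (x * σh + y * σh) mσh≤ax ⟩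
  x * σh + y * σh + a * x       ≡⟨ regroup x y σh a ⟩
  x * (σh + a) + y * σh         ≤⟨ +-mono-≤ (*-monoʳ-≤ x σh+a≤σx) (*-monoʳ-≤ y (slack-antitone a b y≤h)) ⟩
  x * slack a b x + y * slack a b y ∎
  where
  open ≤-Reasoning
  σh : ℕ
  σh = slack a b h
  distrib : ∀ x m y σ → (x + m + y) * σ ≡ x * σ + y * σ + m * σ
  distrib = solve-∀
  regroup : ∀ x y σ a → x * σ + y * σ + a * x ≡ x * (σ + a) + y * σ
  regroup = solve-∀
  mσh≤ax : m * σh ≤ a * x
  mσh≤ax = ≤-trans (*-monoʳ-≤ m (m∸n≤m b (a * ⌊log₂ h ⌋))) (≤-trans (≤-reflexive (*-comm m b)) (<⇒≤ bm<ax))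
  σh+a≤σx : σh + a ≤ slack a b x
  σh+a≤σx = m+n≤o⇒m≤o∸n (σh + a) (begin
    σh + a + a * ⌊log₂ x ⌋       ≡⟨ +-assoc σh a _ ⟩
    σh + (a + a * ⌊log₂ x ⌋)     ≡⟨ cong (σh +_) (*-suc a ⌊log₂ x ⌋) ⟨
    σh + a * (1 + ⌊log₂ x ⌋)     ≤⟨ +-monoʳ-≤ σh (*-monoʳ-≤ a (2*m≤n⇒⌊log₂m⌋<⌊log₂n⌋ 2x≤h)) ⟩
    σh + a * ⌊log₂ h ⌋           ≡⟨ m∸n+n≡m aℓh≤b ⟩
    b                            ∎)

removal-preserves-ratio : ∀ {p p′ h h′ s} → p′ < p → h ≤ h′ + s → p * s < h → p′ * h ≤ p * h′
removal-preserves-ratio {p} {p′} {h} {h′} {s} p′<p h≤h′+s ps<h =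
  <⇒≤ (+-cancelʳ-< h (p′ * h) (p * h′) (begin-strict
  p′ * h + h       ≡⟨ +-comm (p′ * h) h ⟩
  suc p′ * h       ≤⟨ *-monoˡ-≤ h p′<p ⟩
  p * h            ≤⟨ *-monoʳ-≤ p h≤h′+s ⟩
  p * (h′ + s)     ≡⟨ *-distribˡ-+ p h′ s ⟩
  p * h′ + p * s   <⟨ +-monoʳ-< (p * h′) ps<h ⟩
  p * h′ + h       ∎))
  where open ≤-Reasoning

-- Counting in lists

module _ {A : Set} where

  length-filter-∁ : {P : Pred A 0ℓ} (P? : Decidable P) (xs : List A) →
    length (filter P? xs) + length (filter (∁? P?) xs) ≡ length xs
  length-filter-∁ P? []       = refl
  length-filter-∁ P? (x ∷ xs) with P? x
  ... | yes _ = cong suc (length-filter-∁ P? xs)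
  ... | no  _ = trans (+-suc _ _) (cong suc (length-filter-∁ P? xs))

  sublists : List A → List (List A)
  sublists []       = [] ∷ []
  sublists (x ∷ xs) = map (x ∷_) (sublists xs) ++ sublists xs

  ∈-sublists⇒⊆ : ∀ {S} xs → S ∈ sublists xs → S ⊆ xs
  ∈-sublists⇒⊆ []       (here refl) ()
  ∈-sublists⇒⊆ (x ∷ xs) S∈ z∈S with ∈-++⁻ (map (x ∷_) (sublists xs)) S∈
  ... | inj₂ S∈′ = there (∈-sublists⇒⊆ xs S∈′ z∈S)
  ... | inj₁ x∷S′∈ with ∈-map⁻ (x ∷_) x∷S′∈
  ...   | (S′ , S′∈ , refl) with z∈S
  ...     | here z≡x    = here z≡x
  ...     | there z∈S′  = there (∈-sublists⇒⊆ xs S′∈ z∈S′)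

  ∈-sublists⇒Unique : ∀ {S} xs → Unique xs → S ∈ sublists xs → Unique S
  ∈-sublists⇒Unique []       _            (here refl) = []
  ∈-sublists⇒Unique (x ∷ xs) (x∉xs ∷ uxs) S∈ with ∈-++⁻ (map (x ∷_) (sublists xs)) S∈
  ... | inj₂ S∈′ = ∈-sublists⇒Unique xs uxs S∈′
  ... | inj₁ x∷S′∈ with ∈-map⁻ (x ∷_) x∷S′∈
  ...   | (S′ , S′∈ , refl) =
          anti-mono (∈-sublists⇒⊆ xs S′∈) x∉xs ∷ ∈-sublists⇒Unique xs uxs S′∈

  filter∈sublists : {P : Pred A 0ℓ} (P? : Decidable P) (xs : List A) → filter P? xs ∈ sublists xs
  filter∈sublists P? []       = here refl
  filter∈sublists P? (x ∷ xs) with P? x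
  ... | yes _ = ∈-++⁺ˡ (∈-map⁺ (x ∷_) (filter∈sublists P? xs))
  ... | no  _ = ∈-++⁺ʳ (map (x ∷_) (sublists xs)) (filter∈sublists P? xs)

module _ {A : Set} (_≟_ : DecidableEquality A) where

  ⊆⇒length≤ : ∀ {xs ys : List A} → Unique xs → xs ⊆ ys → length xs ≤ length ys
  ⊆⇒length≤ {[]}     _            _     = z≤n
  ⊆⇒length≤ {x ∷ xs} {ys} (x∉xs ∷ uxs) x∷xs⊆ys = begin-strict
    length xs                       ≤⟨ ⊆⇒length≤ uxs xs⊆ys-x ⟩
    length (filter (∁? (x ≟_)) ys)  <⟨ filter-notAll (∁? (x ≟_)) ys x∈ys ⟩
    length ys                       ∎
    where
    open ≤-Reasoning
    x∈ys : Any (λ y → ¬ ¬ x ≡ y) ys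
    x∈ys = Any.map (λ x≡y x≢y → x≢y x≡y) (x∷xs⊆ys (here refl))
    xs⊆ys-x : xs ⊆ filter (∁? (x ≟_)) ys
    xs⊆ys-x y∈xs = ∈-filter⁺ (∁? (x ≟_)) (x∷xs⊆ys (there y∈xs)) (All.lookup x∉xs y∈xs)

  disjoint⇒length+≤ : ∀ {xs ys zs : List A} → Unique xs → Unique ys → Disjoint xs ys →
    xs ⊆ zs → ys ⊆ zs → length xs + length ys ≤ length zs
  disjoint⇒length+≤ {xs} {ys} {zs} uxs uys xs#ys xs⊆zs ys⊆zs =
    subst (_≤ _) (length-++ xs) (⊆⇒length≤ (Unique.++⁺ uxs uys xs#ys) xs++ys⊆zs)
    where
    xs++ys⊆zs : (xs ++ ys) ⊆ zs
    xs++ys⊆zs z∈ = [ xs⊆zs , ys⊆zs ]′ (∈-++⁻ xs z∈)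

  length-filter≡1 : ∀ {P : Pred A 0ℓ} (P? : Decidable P) {xs i} →
    Unique xs → i ∈ xs → P i → (∀ {j} → P j → j ≡ i) → length (filter P? xs) ≡ 1
  length-filter≡1 {P} P? {xs} {i} uxs i∈xs Pi only-i =
    ≤-antisym at-most-one (filter-some P? (Any.map (λ { refl → Pi }) i∈xs))
    where
    at-most-one : length (filter P? xs) ≤ 1
    at-most-one = ⊆⇒length≤ {ys = i ∷ []} (Unique.filter⁺ P? uxs)
      (λ j∈ → here (only-i (proj₂ (∈-filter⁻ P? {xs = xs} j∈))))

module _ {A : Set} {f g : A → ℕ} where

  sum-map-mono : (∀ j → f j ≤ g j) → ∀ xs → sum (map f xs) ≤ sum (map g xs)
  sum-map-mono f≤g []       = z≤n
  sum-map-mono f≤g (x ∷ xs) = +-mono-≤ (f≤g x) (sum-map-mono f≤g xs)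

  sum-map-< : (∀ j → f j ≤ g j) → ∀ {i xs} → f i < g i → i ∈ xs → sum (map f xs) < sum (map g xs)
  sum-map-< f≤g {xs = _ ∷ xs} fi<gi (here refl) = +-mono-<-≤ fi<gi (sum-map-mono f≤g xs)
  sum-map-< f≤g {xs = x ∷ _}  fi<gi (there i∈) = +-mono-≤-< (f≤g x) (sum-map-< f≤g fi<gi i∈)

  sum-map-+ : ∀ xs → sum (map f xs) + sum (map g xs) ≡ sum (map (λ j → f j + g j) xs)
  sum-map-+ []       = refl
  sum-map-+ (x ∷ xs) = trans (interchange (f x) _ (g x) _) (cong (f x + g x +_) (sum-map-+ xs))

-- Blocks and adjacency

module _ {r : ℕ} where

  -- numBlocksAt V i is length (blockKeys V i) by definition.
  blockKeys : List (Vertex r) → Fin r → List (Vertex r)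
  blockKeys V i = deduplicate _≟V_ (map (key i) V)

  blockKeys-unique : ∀ V i → Unique (blockKeys V i)
  blockKeys-unique V i = DecUnique.deduplicate-! _≟V_ (map (key i) V)

  ∈-blockKeys⁺ : ∀ {V i u} → u ∈ V → key i u ∈ blockKeys V i
  ∈-blockKeys⁺ {i = i} u∈V = ∈-deduplicate⁺ _≟V_ (∈-map⁺ (key i) u∈V)

  ∈-blockKeys⁻ : ∀ {V i z} → z ∈ blockKeys V i → ∃ λ u → u ∈ V × z ≡ key i u
  ∈-blockKeys⁻ {V} {i} z∈ = ∈-map⁻ (key i) (∈-deduplicate⁻ _≟V_ (map (key i) V) z∈)

  blockKeys-mono : ∀ {W V} i → W ⊆ V → blockKeys W i ⊆ blockKeys V i
  blockKeys-mono i W⊆V z∈ with ∈-blockKeys⁻ z∈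
  ... | (u , u∈W , refl) = ∈-blockKeys⁺ (W⊆V u∈W)

  BlockDisjoint : Fin r → List (Vertex r) → List (Vertex r) → Set
  BlockDisjoint i X Y = ∀ {u w} → u ∈ X → w ∈ Y → key i u ≢ key i w

  numBlocksAt-mono : ∀ {W V} i → W ⊆ V → numBlocksAt W i ≤ numBlocksAt V i
  numBlocksAt-mono {W} i W⊆V = ⊆⇒length≤ _≟V_ (blockKeys-unique W i) (blockKeys-mono i W⊆V)

  numBlocksAt-disjoint : ∀ {X Y V} i → X ⊆ V → Y ⊆ V → BlockDisjoint i X Y →
    numBlocksAt X i + numBlocksAt Y i ≤ numBlocksAt V i
  numBlocksAt-disjoint {X} {Y} i X⊆V Y⊆V X#Y = disjoint⇒length+≤ _≟V_
    (blockKeys-unique X i) (blockKeys-unique Y i) keys# (blockKeys-mono i X⊆V) (blockKeys-mono i Y⊆V)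
    where
    keys# : Disjoint (blockKeys X i) (blockKeys Y i)
    keys# (z∈X , z∈Y) with ∈-blockKeys⁻ z∈X | ∈-blockKeys⁻ z∈Y
    ... | (u , u∈X , refl) | (w , w∈Y , z≡) = X#Y u∈X w∈Y z≡

  p-< : ∀ {W V v} i → W ⊆ V → v ∈ V → BlockDisjoint i W (v ∷ []) → p W < p V
  p-< {W} {V} {v} i W⊆V v∈V W#v = sum-map-< (λ j → numBlocksAt-mono j W⊆V) fewer (∈-allFin i)
    where
    fewer : numBlocksAt W i < numBlocksAt V i
    fewer = subst (_≤ numBlocksAt V i) (+-comm (numBlocksAt W i) 1)
      (numBlocksAt-disjoint i W⊆V (λ { (here refl) → v∈V ; (there ()) }) W#v)

  p-disjoint : ∀ {X Y V} → X ⊆ V → Y ⊆ V → (∀ i → BlockDisjoint i X Y) → p X + p Y ≤ p V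
  p-disjoint {X} {Y} {V} X⊆V Y⊆V X#Y = begin
    p X + p Y    ≡⟨ sum-map-+ (allFin r) ⟩
    sum (map (λ i → numBlocksAt X i + numBlocksAt Y i) (allFin r))
                 ≤⟨ sum-map-mono (λ i → numBlocksAt-disjoint i X⊆V Y⊆V (X#Y i)) (allFin r) ⟩
    p V          ∎
    where open ≤-Reasoning

module _ {r : ℕ} {i : Fin r} {u w : Vertex r} (sameBlock : key i u ≡ key i w) where

  sameBlock⇒lookup≡ : ∀ {j} → j ≢ i → lookup u j ≡ lookup w j
  sameBlock⇒lookup≡ {j} j≢i = begin
    lookup u j         ≡⟨ lookup∘update′ j≢i u 0 ⟨
    lookup (key i u) j ≡⟨ cong (λ z → lookup z _) sameBlock ⟩
    lookup (key i w) j ≡⟨ lookup∘update′ j≢i w 0 ⟩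
    lookup w j         ∎
    where open ≡-Reasoning

  sameBlock⇒≡ : lookup u i ≡ lookup w i → u ≡ w
  sameBlock⇒≡ uᵢ≡wᵢ = begin
    u                              ≡⟨ []≔-lookup u i ⟨
    u [ i ]≔ lookup u i            ≡⟨ []≔-idempotent u i ⟨
    key i u [ i ]≔ lookup u i      ≡⟨ cong₂ (λ z x → z [ i ]≔ x) sameBlock uᵢ≡wᵢ ⟩
    key i w [ i ]≔ lookup w i      ≡⟨ []≔-idempotent w i ⟩
    w [ i ]≔ lookup w i            ≡⟨ []≔-lookup w i ⟩
    w                              ∎
    where open ≡-Reasoning

  sameBlock⇒adjacent : u ≢ w → diffCount u w ≡ 1
  sameBlock⇒adjacent u≢w = length-filter≡1 _≟F_ (λ j → ¬? (lookup u j ≟ lookup w j))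
    (Unique.allFin⁺ r) (∈-allFin i) (u≢w ∘ sameBlock⇒≡) differs-only-at-i
    where
    differs-only-at-i : ∀ {j} → lookup u j ≢ lookup w j → j ≡ i
    differs-only-at-i {j} uⱼ≢wⱼ with j ≟F i
    ... | yes j≡i = j≡i
    ... | no  j≢i = contradiction (sameBlock⇒lookup≡ j≢i) uⱼ≢wⱼ

-- The deciders of Defs.N, so that N V X is filter (neighbour? X) V by definition.
module _ {r : ℕ} (X : List (Vertex r)) where

  member? : Decidable (λ v → Any (_≡ v) X)
  member? v = any? (_≟V v) X

  adjacent? : Decidable (λ v → Any (λ x → diffCount x v ≡ 1) X)
  adjacent? v = any? (λ x → diffCount x v ≟ 1) X

  neighbour? : Decidable (λ v → ¬ Any (_≡ v) X × Any (λ x → diffCount x v ≡ 1) X)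
  neighbour? v = ¬? (member? v) ×-dec adjacent? v

  far? : Decidable (λ v → ¬ (Any (_≡ v) X ⊎ Any (λ x → diffCount x v ≡ 1) X))
  far? v = ¬? (member? v ⊎-dec adjacent? v)

N-cong : ∀ {r} {V X Y : List (Vertex r)} → X ⊆ Y → Y ⊆ X → N V Y ⊆ N V X
N-cong {V = V} {X} {Y} X⊆Y Y⊆X z∈N =
  let z∈V , z∉Y , adjY = ∈-filter⁻ (neighbour? Y) {xs = V} z∈N
  in  ∈-filter⁺ (neighbour? X) z∈V (z∉Y ∘ Any-resp-⊆ X⊆Y , Any-resp-⊆ Y⊆X adjY)

far : ∀ {r} → List (Vertex r) → List (Vertex r) → List (Vertex r)
far H S = filter (far? S) H

module _ {r : ℕ} (H S : List (Vertex r)) where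

  far-split : H ⊆ (S ++ N H S) ++ far H S
  far-split {v} v∈H with member? S v | adjacent? S v
  ... | yes v∈S | _        = ∈-++⁺ˡ (∈-++⁺ˡ (Any.map sym v∈S))
  ... | no  v∉S | yes adj  = ∈-++⁺ˡ (∈-++⁺ʳ S (∈-filter⁺ (neighbour? S) v∈H (v∉S , adj)))
  ... | no  v∉S | no  ¬adj = ∈-++⁺ʳ _ (∈-filter⁺ (far? S) v∈H [ v∉S , ¬adj ]′)

  far-disjoint : Disjoint S (far H S)
  far-disjoint (v∈S , v∈far) = proj₂ (∈-filter⁻ (far? S) {xs = H} v∈far) (inj₁ (Any.map sym v∈S))

  far-blockDisjoint : ∀ i → BlockDisjoint i S (far H S)
  far-blockDisjoint i {u} {w} u∈S w∈far sameBlock with u ≟V w | proj₂ (∈-filter⁻ (far? S) {xs = H} w∈far)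
  ... | yes refl | ¬near = ¬near (inj₁ (lose u∈S refl))
  ... | no  u≢w  | ¬near = ¬near (inj₂ (lose u∈S (sameBlock⇒adjacent sameBlock u≢w)))

-- The descent

descend : ∀ {A : Set} {P Q : A → Set} (μ : A → ℕ) →
  (∀ {x} → P x → (∃ λ y → P y × μ y < μ x) ⊎ Q x) →
  ∀ {x} → P x → ∃ λ y → P y × Q y
descend {A} {P} {Q} μ step = go (<-wellFounded _)
  where
  go : ∀ {x} → Acc _<_ (μ x) → P x → ∃ λ y → P y × Q y
  go (acc rs) px with step px
  ... | inj₁ (y , py , μy<μx) = go (rs μy<μx) py
  ... | inj₂ qx               = _ , px , qx

module Descent {r : ℕ} (V₀ : List (Vertex r)) (λ′ : ℚ)
               (λ-small : 2 * (num λ′ * ⌊log₂ length V₀ ⌋) ≤ den λ′) where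

  n pG a b : ℕ
  n  = length V₀
  pG = p V₀
  a  = num λ′
  b  = den λ′

  σ : ℕ → ℕ
  σ = slack a b

  -- As σ h = b (1 − λ⌊log₂ h⌋) and dens = r |V| / p, this is the invariant of the
  -- header with denominators cleared.
  DenseEnough : ℕ → ℕ → Set
  DenseEnough pH h = pH * n * σ n ≤ pG * h * σ h

  aℓ≤b : ∀ {h} → h ≤ n → a * ⌊log₂ h ⌋ ≤ b
  aℓ≤b h≤n = ≤-trans (*-monoʳ-≤ a (⌊log₂⌋-mono-≤ h≤n)) (≤-trans (m≤m+n _ _) λ-small)

  b≤2σn : b ≤ 2 * σ n
  b≤2σn = begin
    b                ≡⟨ m∸n+n≡m aℓn≤b ⟨
    σ n + aℓn        ≤⟨ +-monoʳ-≤ (σ n) (m+n≤o⇒m≤o∸n aℓn aℓn+aℓn≤b) ⟩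
    σ n + σ n        ≡⟨ cong (σ n +_) (+-identityʳ (σ n)) ⟨
    2 * σ n          ∎
    where
    open ≤-Reasoning
    aℓn : ℕ
    aℓn = a * ⌊log₂ n ⌋
    aℓn≤b : aℓn ≤ b
    aℓn≤b = aℓ≤b ≤-refl
    aℓn+aℓn≤b : aℓn + aℓn ≤ b
    aℓn+aℓn≤b = subst (_≤ b) (cong (aℓn +_) (+-identityʳ aℓn)) λ-small

  -- den λ′ is a successor by construction, so 1 ≤ b.
  instance
    σn-nonZero : NonZero (σ n)
    σn-nonZero = >-nonZero (*-cancelˡ-< 2 0 (σ n) (≤-trans (s≤s z≤n) b≤2σn))

  dense⇒ratio : ∀ {pH h} → DenseEnough pH h → pH * n ≤ 2 * pG * h
  dense⇒ratio {pH} {h} dense = *-cancelʳ-≤ (pH * n) (2 * pG * h) (σ n) (begin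
    pH * n * σ n          ≤⟨ dense ⟩
    pG * h * σ h          ≤⟨ *-monoʳ-≤ (pG * h) (≤-trans (m∸n≤m b (a * ⌊log₂ h ⌋)) b≤2σn) ⟩
    pG * h * (2 * σ n)    ≡⟨ reassoc pG h (σ n) ⟩
    2 * pG * h * σ n      ∎)
    where
    open ≤-Reasoning
    reassoc : ∀ x y z → x * y * (2 * z) ≡ 2 * x * y * z
    reassoc = solve-∀

  dense⇒small-block : ∀ {pH h s} .{{_ : NonZero h}} → DenseEnough pH h → 2 * pG * s < n → pH * s < h
  dense⇒small-block {pH} {h} {s} dense 2pGs<n = *-cancelʳ-< n (pH * s) h (begin-strict
    pH * s * n        ≡⟨ swap pH s n ⟩
    pH * n * s        ≤⟨ *-monoˡ-≤ s (dense⇒ratio {pH} {h} dense) ⟩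
    2 * pG * h * s    ≡⟨ regroup pG h s ⟩
    h * (2 * pG * s)  <⟨ *-monoʳ-< h 2pGs<n ⟩
    h * n             ∎)
    where
    open ≤-Reasoning
    swap : ∀ p s n → p * s * n ≡ p * n * s
    swap = solve-∀
    regroup : ∀ g h s → 2 * g * h * s ≡ h * (2 * g * s)
    regroup = solve-∀

  dense-removal : ∀ {pH p′ h h′ s} .{{_ : NonZero h}} → p′ < pH → h ≤ h′ + s → h′ ≤ h →
    2 * pG * s < n → DenseEnough pH h → DenseEnough p′ h′ × 0 < h′
  dense-removal {pH} {p′} {h} {h′} {s} p′<pH h≤h′+s h′≤h 2pGs<n dense =
    *-cancelʳ-≤ (p′ * n * σ n) (pG * h′ * σ h′) h (begin
      p′ * n * σ n * h      ≡⟨ swap₁ p′ n (σ n) h ⟩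
      (p′ * h) * (n * σ n)  ≤⟨ *-monoˡ-≤ (n * σ n) (removal-preserves-ratio p′<pH h≤h′+s pHs<h) ⟩
      (pH * h′) * (n * σ n) ≡⟨ swap₂ pH h′ n (σ n) ⟩
      h′ * (pH * n * σ n)   ≤⟨ *-monoʳ-≤ h′ dense ⟩
      h′ * (pG * h * σ h)   ≤⟨ *-monoʳ-≤ h′ (*-monoʳ-≤ (pG * h) (slack-antitone a b h′≤h)) ⟩
      h′ * (pG * h * σ h′)  ≡⟨ swap₃ h′ pG h (σ h′) ⟩
      pG * h′ * σ h′ * h    ∎)
    , +-cancelʳ-< s 0 h′ (begin-strict
      s        ≤⟨ m≤n*m s pH {{>-nonZero (≤-<-trans z≤n p′<pH)}} ⟩
      pH * s   <⟨ pHs<h ⟩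
      h        ≤⟨ h≤h′+s ⟩
      h′ + s   ∎)
    where
    open ≤-Reasoning
    swap₁ : ∀ p n σ h → p * n * σ * h ≡ (p * h) * (n * σ)
    swap₁ = solve-∀
    swap₂ : ∀ p h n σ → (p * h) * (n * σ) ≡ h * (p * n * σ)
    swap₂ = solve-∀
    swap₃ : ∀ h′ pG h σ → h′ * (pG * h * σ) ≡ pG * h′ * σ * h
    swap₃ = solve-∀
    pHs<h : pH * s < h
    pHs<h = dense⇒small-block {pH} dense 2pGs<n

  split-cannot-lose-both : ∀ {pH px py h x y} → px + py ≤ pH → h * σ h ≤ x * σ x + y * σ y →
    DenseEnough pH h → pG * x * σ x < px * n * σ n → ¬ (pG * y * σ y ≤ py * n * σ n)
  split-cannot-lose-both {pH} {px} {py} {h} {x} {y} px+py≤pH weights dense x-loses y-loses =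
    <-irrefl refl (begin-strict
    pG * (x * σ x + y * σ y)     ≡⟨ distribute pG x (σ x) y (σ y) ⟩
    pG * x * σ x + pG * y * σ y  <⟨ +-mono-<-≤ x-loses y-loses ⟩
    px * n * σ n + py * n * σ n  ≡⟨ collect px py n (σ n) ⟩
    (px + py) * n * σ n          ≤⟨ *-monoˡ-≤ (σ n) (*-monoˡ-≤ n px+py≤pH) ⟩
    pH * n * σ n                 ≤⟨ dense ⟩
    pG * h * σ h                 ≡⟨ *-assoc pG h (σ h) ⟩
    pG * (h * σ h)               ≤⟨ *-monoʳ-≤ pG weights ⟩
    pG * (x * σ x + y * σ y)     ∎)
    where
    open ≤-Reasoning
    distribute : ∀ g x s y t → g * (x * s + y * t) ≡ g * x * s + g * y * t
    distribute = solve-∀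
    collect : ∀ p q n s → p * n * s + q * n * s ≡ (p + q) * n * s
    collect = solve-∀

  dense-split : ∀ {pH px py h x y} → px + py ≤ pH → h * σ h ≤ x * σ x + y * σ y →
    DenseEnough pH h → DenseEnough px x ⊎ (DenseEnough py y × 0 < y)
  dense-split {pH} {px} {py} {h} {x} {y} px+py≤pH weights dense with px * n * σ n ≤? pG * x * σ x
  ... | yes denseX = inj₁ denseX
  ... | no ¬denseX = inj₂ (≮⇒≥ (loss ∘ <⇒≤) , n≢0⇒n>0 y≢0)
    where
    loss : ¬ (pG * y * σ y ≤ py * n * σ n)
    loss = split-cannot-lose-both {pH} {px} {py} {h} {x} {y} px+py≤pH weights dense (≰⇒> ¬denseX)
    y≢0 : y ≢ 0
    y≢0 refl = loss (≤-trans (≤-reflexive (cong (_* σ 0) (*-zeroʳ pG))) z≤n)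

  dense⇒log-bound : ∀ {pH h} → DenseEnough pH h → (pH * n ∸ h * pG) * b ≤ ⌊log₂ n ⌋ * (a * n * pH)
  dense⇒log-bound {pH} {h} dense = begin
    (pH * n ∸ h * pG) * b         ≡⟨ *-distribʳ-∸ b (pH * n) (h * pG) ⟩
    pH * n * b ∸ h * pG * b       ≤⟨ m≤n+o⇒m∸n≤o (pH * n * b) (h * pG * b) (begin
      pH * n * b                               ≡⟨ cong (pH * n *_) (m∸n+n≡m aℓn≤b) ⟨
      pH * n * (σ n + a * ℓn)                  ≡⟨ expand pH n (σ n) a ℓn ⟩
      pH * n * σ n + ℓn * (a * n * pH)         ≤⟨ +-monoˡ-≤ _ dense ⟩
      pG * h * σ h + ℓn * (a * n * pH)         ≤⟨ +-monoˡ-≤ _ (*-monoʳ-≤ (pG * h) (m∸n≤m b (a * ⌊log₂ h ⌋))) ⟩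
      pG * h * b + ℓn * (a * n * pH)           ≡⟨ cong (λ z → z * b + ℓn * (a * n * pH)) (*-comm pG h) ⟩
      h * pG * b + ℓn * (a * n * pH)           ∎) ⟩
    ℓn * (a * n * pH)             ∎
    where
    open ≤-Reasoning
    ℓn : ℕ
    ℓn = ⌊log₂ n ⌋
    aℓn≤b : a * ℓn ≤ b
    aℓn≤b = aℓ≤b ≤-refl
    expand : ∀ p n s a l → p * n * (s + a * l) ≡ p * n * s + l * (a * n * p)
    expand = solve-∀

  record Admissible (H : List (Vertex r)) : Set where
    field
      distinct : Unique H
      ⊆V₀      : H ⊆ V₀
      nonempty : 0 < length H
      dense    : DenseEnough (p H) (length H)
  open Admissible public

  Smaller : List (Vertex r) → Set
  Smaller H = ∃ λ H′ → Admissible H′ × length H′ < length H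

  shrink : ∀ {H H′} → Admissible H → H′ ⊆ H → Unique H′ → 0 < length H′ →
    DenseEnough (p H′) (length H′) → length H′ < length H → Smaller H
  shrink adm H′⊆H uH′ 0<h′ dense′ h′<h = _ , record
    { distinct = uH′ ; ⊆V₀ = ⊆-trans H′⊆H (⊆V₀ adm) ; nonempty = 0<h′ ; dense = dense′ } , h′<h

  remove-block : ∀ {H v} i → Admissible H → v ∈ H → 2 * pG * length (block H i v) < n → Smaller H
  remove-block {H} {v} i adm v∈H small =
    let dense′ , 0<h′ = dense-removal {{>-nonZero (nonempty adm)}} (p-< i H′⊆H v∈H H′#v) h≤h′+s
                                      (length-filter (∁? sameBlock?) H) small (dense adm)
    in  shrink adm H′⊆H (Unique.filter⁺ (∁? sameBlock?) (distinct adm)) 0<h′ dense′ h′<h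
    where
    sameBlock? : Decidable (λ u → key i u ≡ key i v)
    sameBlock? u = key i u ≟V key i v
    H′ : List (Vertex r)
    H′ = filter (∁? sameBlock?) H
    H′⊆H : H′ ⊆ H
    H′⊆H = filter-⊆ (∁? sameBlock?) H
    H′#v : BlockDisjoint i H′ (v ∷ [])
    H′#v u∈H′ (here refl) = proj₂ (∈-filter⁻ (∁? sameBlock?) {xs = H} u∈H′)
    h≤h′+s : length H ≤ length H′ + length (block H i v)
    h≤h′+s = ≤-reflexive (trans (sym (length-filter-∁ sameBlock? H)) (+-comm _ (length H′)))
    h′<h : length H′ < length H
    h′<h = filter-notAll (∁? sameBlock?) H (lose v∈H (λ different → different refl))

  length≤n : ∀ {H} → Admissible H → length H ≤ n
  length≤n adm = ⊆⇒length≤ _≟V_ (distinct adm) (⊆V₀ adm)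

  split-off : ∀ {H S} → Admissible H → Unique S → S ⊆ H →
    2 * length S ≤ length H → b * length (N H S) < a * length S → Smaller H
  split-off {H} {S} adm uS S⊆H 2s≤h expansion-fails =
    [ (λ denseS → shrink adm S⊆H uS 0<s denseS s<h)
    , (λ (denseY , 0<y) → shrink adm Y⊆H uY 0<y denseY y<h)
    ]′ (dense-split {p H} {p S} {p Y} {h} {s} {y} pS+pY≤pH weights (dense adm))
    where
    Y : List (Vertex r)
    Y = far H S
    Y⊆H : Y ⊆ H
    Y⊆H = filter-⊆ (far? S) H
    uY : Unique Y
    uY = Unique.filter⁺ (far? S) (distinct adm)
    s h m y : ℕ
    s = length S
    h = length H
    m = length (N H S)
    y = length Y
    0<s : 0 < s
    0<s = n≢0⇒n>0 λ s≡0 → n≮0 (subst (b * m <_) (trans (cong (a *_) s≡0) (*-zeroʳ a)) expansion-fails)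
    s<h : s < h
    s<h = <-≤-trans (m<m+n s 0<s) (subst (_≤ h) (cong (s +_) (+-identityʳ s)) 2s≤h)
    y<h : y < h
    y<h = <-≤-trans (m<n+m y 0<s) (disjoint⇒length+≤ _≟V_ uS uY (far-disjoint H S) S⊆H Y⊆H)
    h≤s+m+y : h ≤ s + m + y
    h≤s+m+y = begin
      h                                  ≤⟨ ⊆⇒length≤ _≟V_ (distinct adm) (far-split H S) ⟩
      length ((S ++ N H S) ++ Y)         ≡⟨ length-++ (S ++ N H S) ⟩
      length (S ++ N H S) + y            ≡⟨ cong (_+ y) (length-++ S) ⟩
      s + m + y                          ∎
      where open ≤-Reasoning
    pS+pY≤pH : p S + p Y ≤ p H
    pS+pY≤pH = p-disjoint S⊆H Y⊆H (far-blockDisjoint H S)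
    weights : h * σ h ≤ s * σ s + y * σ y
    weights = slack-split a b {{>-nonZero 0<s}} (aℓ≤b (length≤n adm)) h≤s+m+y 2s≤h
                          (length-filter (far? S) H) expansion-fails

  SmallBlockAt : List (Vertex r) → Vertex r → Set
  SmallBlockAt H v = Any (λ i → 2 * pG * length (block H i v) < n) (allFin r)

  ExpansionFails : List (Vertex r) → List (Vertex r) → Set
  ExpansionFails H S = 2 * length S ≤ length H × b * length (N H S) < a * length S

  smallBlockAt? : ∀ H → Decidable (SmallBlockAt H)
  smallBlockAt? H v = any? (λ i → 2 * pG * length (block H i v) <? n) (allFin r)

  expansionFails? : ∀ H → Decidable (ExpansionFails H)
  expansionFails? H S = (2 * length S ≤? length H) ×-dec (b * length (N H S) <? a * length S)

  ¬SmallBlock⇒MinBlockBound : ∀ {H} → ¬ Any (SmallBlockAt H) H → MinBlockBound V₀ H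
  ¬SmallBlock⇒MinBlockBound ¬small v v∈H i = ≮⇒≥ (λ small → ¬small (lose v∈H (lose (∈-allFin i) small)))

  ¬ExpansionFails⇒IsExpander : ∀ {H} → Unique H → ¬ Any (ExpansionFails H) (sublists H) → IsExpander λ′ H
  ¬ExpansionFails⇒IsExpander {H} uH ¬fails X uX X⊆H 2x≤h = begin
    a * length X          ≤⟨ *-monoʳ-≤ a (⊆⇒length≤ _≟V_ uX X⊆X′) ⟩
    a * length X′         ≤⟨ ≮⇒≥ (λ fails → ¬fails (lose (filter∈sublists (member? X) H) (2x′≤h , fails))) ⟩
    b * length (N H X′)   ≤⟨ *-monoʳ-≤ b (⊆⇒length≤ _≟V_ (Unique.filter⁺ (neighbour? X′) uH) N′⊆N) ⟩
    b * length (N H X)    ∎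
    where
    open ≤-Reasoning
    X′ : List (Vertex r)
    X′ = filter (member? X) H
    X⊆X′ : X ⊆ X′
    X⊆X′ x∈X = ∈-filter⁺ (member? X) (X⊆H x∈X) (Any.map sym x∈X)
    X′⊆X : X′ ⊆ X
    X′⊆X x∈X′ = Any.map sym (proj₂ (∈-filter⁻ (member? X) {xs = H} x∈X′))
    N′⊆N : N H X′ ⊆ N H X
    N′⊆N = N-cong {V = H} X⊆X′ X′⊆X
    2x′≤h : 2 * length X′ ≤ length H
    2x′≤h = ≤-trans (*-monoʳ-≤ 2 (⊆⇒length≤ _≟V_ (Unique.filter⁺ (member? X) uH) X′⊆X)) 2x≤h

  improve-or-finish : ∀ {H} → Admissible H → Smaller H ⊎ (IsExpander λ′ H × MinBlockBound V₀ H)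
  improve-or-finish {H} adm with any? (smallBlockAt? H) H
  ... | yes small =
        let v , v∈H , smallAt-v = find small
            i , _   , small-i  = find smallAt-v
        in  inj₁ (remove-block i adm v∈H small-i)
  ... | no ¬small with any? (expansionFails? H) (sublists H)
  ...   | yes fails =
          let S , S∈ , 2s≤h , expansion-fails = find fails
          in  inj₁ (split-off adm (∈-sublists⇒Unique H (distinct adm) S∈) (∈-sublists⇒⊆ H S∈)
                              2s≤h expansion-fails)
  ...   | no ¬fails =
          inj₂ (¬ExpansionFails⇒IsExpander (distinct adm) ¬fails , ¬SmallBlock⇒MinBlockBound ¬small)

lemma3p3 : (r : ℕ) → 1 ≤ r → (G : VSet r) → 1 ≤ ∣ G ∣V →
    (λ′ : ℚ) → 0ℚ <ℚ λ′ → λ≤1/2log λ′ ∣ G ∣V →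
    Σ (List (Vertex r)) (λ H →
      Unique H × H ⊆ verts G × 1 ≤ length H ×
      DensBound λ′ (verts G) H ×
      IsExpander λ′ H ×
      MinBlockBound (verts G) H)
lemma3p3 r _ G 1≤n λ′ _ λ≤ =
  let H , adm , expander , minBlock = descend length improve-or-finish initial
  in  H , distinct adm , ⊆V₀ adm , nonempty adm ,
      ≤⌊log₂⌋*⇒2^≤^ n _ _ (dense⇒log-bound (dense adm)) , expander , minBlock
  where
  n : ℕ
  n = ∣ G ∣V
  instance
    n-nonZero : NonZero n
    n-nonZero = >-nonZero 1≤n
  λ-small : 2 * (num λ′ * ⌊log₂ n ⌋) ≤ den λ′
  λ-small = begin
    2 * (num λ′ * ⌊log₂ n ⌋)  ≡⟨ *-assoc 2 (num λ′) ⌊log₂ n ⌋ ⟨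
    2 * num λ′ * ⌊log₂ n ⌋    ≡⟨ *-comm (2 * num λ′) ⌊log₂ n ⌋ ⟩
    ⌊log₂ n ⌋ * (2 * num λ′)  ≤⟨ ^≤2^⇒⌊log₂⌋*≤ n (2 * num λ′) (den λ′) λ≤ ⟩
    den λ′                    ∎
    where open ≤-Reasoning
  open Descent (verts G) λ′ λ-small
    using (Admissible; distinct; ⊆V₀; nonempty; dense; improve-or-finish; dense⇒log-bound)
  initial : Admissible (verts G)
  initial = record { distinct = unique G ; ⊆V₀ = id ; nonempty = 1≤n ; dense = ≤-refl }
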